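{- Let $p$ be a prime, let $M$ be an $n$-spike representable over $GF(p)$, and let $A$ be a special standard representation of $M$ over $GF(p)$ with diagonal $\vec x=(x_1,\dots,x_n)$. Suppose that $n=2p-2$, $x_1=x_2=\cdots=x_p=-1$, and $x_{p+1}=\cdots=x_{2p-2}=1$. Then for every prime $q\ge p$, the same matrix $A$ (i.e. the matrix with the same integer entries $0,1,2$, read in $GF(q)$) represents $M$ over $GF(q)$.
   Context: For an integer $n\ge 3$, a matroid $M$ is an $n$-spike (with tip $t$) if (i) its ground set is the union of $n$ lines $L_1,\dots,L_n$, each having exactly three points and all passing through a common point $t$; (ii) $r(L_1\cup\cdots\cup L_k)=k+1$ for all $k\in\{1,\dots,n-1\}$; and (iii) $r(L_1\cup\cdots\cup L_n)=n$. If $M$ is representable over a field $F$ and $\{b_1,\dots,b_n\}$ is a basis with $b_i\in L_i\setminus\{t\}$, then $M$ is represented over $F$ by an $n\times(2n+1)$ matrix $[I_n\mid \mathbf{1}\mid B]$, where column $i$ ($1\le i\le n$) corresponds to $b_i$, column $n+1$ is the all-ones vector and corresponds to the tip $t$, and column $n+1+i$ corresponds to the other non-tip element of $L_i$ and equals the all-ones vector plus $x_i$ times the $i$-th standard unit vector, where $x_i\in F$. Such a matrix is a special standard representation and $(x_1,\dots,x_n)$ is its diagonal. -}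

module Defs where

open import Data.Nat as ℕ using (ℕ; zero; suc; _<_; _≤_; _≥_; _<?_)
open import Data.Integer as ℤ using (ℤ; +_; -_)
open import Data.Integer.Divisibility using () renaming (_∣_ to _∣ℤ_)
open import Data.Fin using (Fin; zero; suc; toℕ; splitAt; _↑ˡ_; _↑ʳ_)
open import Data.Fin.Subset using (Subset; _⊆_; _∈_; _∉_; _∪_; ⁅_⁆; ∣_∣; ⋃)
open import Data.List using (List; map; filter; allFin)
open import Data.Product using (Σ; ∃; _×_)
open import Data.Sum using (inj₁; inj₂)
open import Function.Bundles using (_⇔_)
open import Relation.Binary.PropositionalEquality using (_≡_)
open import Relation.Unary using (Pred)

record Matroid (m : ℕ) : Set₁ where
  field
    Indep     : Subset m → Set
    indep-∅   : Indep Data.Fin.Subset.⊥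
    indep-⊆   : ∀ {I J} → J ⊆ I → Indep I → Indep J
    indep-aug : ∀ {I J} → Indep I → Indep J → ∣ I ∣ < ∣ J ∣ →
                ∃ λ e → e ∈ J × e ∉ I × Indep (I ∪ ⁅ e ⁆)

HasRank : ∀ {m} → Matroid m → Subset m → ℕ → Set
HasRank M X k =
  (∃ λ I → I ⊆ X × Matroid.Indep M I × ∣ I ∣ ≡ k) ×
  (∀ I → I ⊆ X → Matroid.Indep M I → ∣ I ∣ ≤ k)

-- Labelling of the ground set Fin (n + suc n) of an n-spike, following
-- the column order of a special standard representation [I_n | 1 | B]:
--   columns 0..n-1     : b_1 .. b_n
--   column  n          : the tip t
--   columns n+1..2n    : the other non-tip element of L_1 .. L_n

basisElt : ∀ {n} → Fin n → Fin (n ℕ.+ suc n)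
basisElt {n} k = k ↑ˡ suc n

tip : ∀ {n} → Fin (n ℕ.+ suc n)
tip {n} = n ↑ʳ zero

otherElt : ∀ {n} → Fin n → Fin (n ℕ.+ suc n)
otherElt {n} k = n ↑ʳ suc k

line : ∀ {n} → Fin n → Subset (n ℕ.+ suc n)
line k = (⁅ basisElt k ⁆ ∪ ⁅ tip ⁆) ∪ ⁅ otherElt k ⁆

firstLines : (n k : ℕ) → Subset (n ℕ.+ suc n)
firstLines n k = ⋃ (map line (filter (λ i → toℕ i <? k) (allFin n)))

basisSet : ∀ n → Subset (n ℕ.+ suc n)
basisSet n = ⋃ (map (λ k → ⁅ basisElt k ⁆) (allFin n))

-- M is an n-spike with tip t and lines L_1..L_n (labelled as above);
-- the ground set is the union of the lines by construction.
IsSpike : ∀ n → Matroid (n ℕ.+ suc n) → Set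
IsSpike n M =
  (n ≥ 3) ×
  (∀ k → ∣ line {n} k ∣ ≡ 3 × HasRank M (line k) 2) ×
  (∀ k → 1 ≤ k → k < n → HasRank M (firstLines n k) (suc k)) ×
  HasRank M (firstLines n n) n

sumFin : ∀ {m} → (Fin m → ℤ) → ℤ
sumFin {zero}  f = + 0
sumFin {suc m} f = f zero ℤ.+ sumFin (λ j → f (suc j))

-- the columns of A indexed by S are linearly independent over GF(p):
-- every GF(p)-linear dependency supported on S is trivial
-- (coefficients are integer lifts of elements of GF(p)).
LinIndepMod : ℕ → ∀ {r m} → (Fin r → Fin m → ℤ) → Subset m → Set
LinIndepMod p {r} {m} A S =
  ∀ (c : Fin m → ℤ) →
  (∀ j → j ∉ S → c j ≡ + 0) →
  (∀ i → (+ p) ∣ℤ sumFin (λ j → c j ℤ.* A i j)) →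
  ∀ j → (+ p) ∣ℤ c j

Represents : ℕ → ∀ {r m} → (Fin r → Fin m → ℤ) → Matroid m → Set
Represents p A M = ∀ S → Matroid.Indep M S ⇔ LinIndepMod p A S

kronecker : ∀ {n} → Fin n → Fin n → ℤ
kronecker zero    zero    = + 1
kronecker zero    (suc _) = + 0
kronecker (suc _) zero    = + 0
kronecker (suc i) (suc j) = kronecker i j

specialMatrix : ∀ n → (Fin n → ℤ) → Fin n → Fin (n ℕ.+ suc n) → ℤ
specialMatrix n x i j with splitAt n j
... | inj₁ k       = kronecker i k
... | inj₂ zero    = + 1
... | inj₂ (suc k) = + 1 ℤ.+ x k ℤ.* kronecker i k

IsSpecialStdRep : ℕ → ∀ n → Matroid (n ℕ.+ suc n) → (Fin n → ℤ) → Set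
IsSpecialStdRep p n M x =
  IsSpike n M × Matroid.Indep M (basisSet n) × Represents p (specialMatrix n x) M

{-# OPTIONS --safe #-}
module Submission where

-- Write bₖ, t, cₖ for the columns eₖ, 𝟙, 𝟙 + xₖ eₖ of the special matrix, so that cₖ = t + xₖ bₖ and
-- xₖ² = 1.  Over GF(P), for any prime P, a set S of columns is independent exactly when either
--   * S avoids both bₖ and cₖ for some k, contains both bₖ and cₖ for at most one k, and for none if t ∈ S;
--   * or t ∉ S, S never contains both bₖ and cₖ, and P ∤ weight S = 1 + Σ_{bₖ ∉ S} xₖ.
-- Each dependent shape carries an integer relation with a ±1 coefficient, valid in every characteristic:
-- a line cₖ − t − xₖ bₖ, the difference of two lines, the transversal relation
-- Σ_{bₖ ∈ S} bₖ + Σ_{bₖ ∉ S} xₖ cₖ = (weight S) t, or the latter with t eliminated by a line.  Conversely a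
-- dependency modulo P is killed row by row, once P divides the common part c(t) + Σ c(cₖ) of the rows.
-- Since x has p entries −1 and p − 2 entries +1, 1 − p ≤ weight S ≤ p − 1; so for primes P ≥ p, P divides
-- weight S only if it vanishes, and the criterion reads the same over GF(p) and GF(q).

open import Defs
open import Data.Nat.Primality using (Prime)
open import Data.Integer using (ℤ; +_; -_)
open import Data.Fin using (Fin; toℕ)
open import Relation.Binary.PropositionalEquality using (_≡_)

import Data.Nat as ℕ
import Data.Integer as ℤ
open import Data.Fin using (zero; suc; _↑ˡ_; _↑ʳ_)
open import Data.Fin.Subset using (Subset; _∈_; _∉_)
open import Data.Product using (∃; _×_; _,_; proj₁; proj₂)
open import Data.Sum using (_⊎_; inj₁; inj₂; [_,_]′)
open import Data.Empty using (⊥-elim)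
open import Function using (_∘_)
open import Relation.Binary.PropositionalEquality
  using (refl; sym; trans; cong; cong₂; subst; _≢_; module ≡-Reasoning)
open import Relation.Nullary using (¬_)

module Sums where
  open import Data.Integer using (0ℤ; 1ℤ; -1ℤ; _+_; _*_; _≤_; +≤+)
  open import Data.Integer.Properties
    using (+-*-semiring; +-identityˡ; +-identityʳ; +-assoc; *-zeroʳ; *-identityʳ;
           +-mono-≤; neg-suc; neg-≤-pos)
  open import Algebra.Properties.Semiring.Sum +-*-semiring
    using (sum; sum-cong-≗; sum-replicate-zero; ∑-distrib-+; *-distribˡ-sum; *-distribʳ-sum) public
  open ≡-Reasoning

  sumFin≡sum : ∀ {m} (f : Fin m → ℤ) → sumFin f ≡ sum f
  sumFin≡sum {ℕ.zero} f = refl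
  sumFin≡sum {ℕ.suc m} f = cong (λ z → f zero + z) (sumFin≡sum (f ∘ suc))

  sum-zero : ∀ {m} {f : Fin m → ℤ} → (∀ i → f i ≡ 0ℤ) → sum f ≡ 0ℤ
  sum-zero {m} f≡0 = trans (sum-cong-≗ f≡0) (sum-replicate-zero m)

  sum-↑ : ∀ m {k} (f : Fin (m ℕ.+ k) → ℤ) →
          sum f ≡ sum (λ i → f (i ↑ˡ k)) + sum (λ j → f (m ↑ʳ j))
  sum-↑ ℕ.zero    f = sym (+-identityˡ (sum f))
  sum-↑ (ℕ.suc m) f = trans (cong (λ z → f zero + z) (sum-↑ m (f ∘ suc))) (sym (+-assoc (f zero) _ _))

  kronecker-diag : ∀ {m} (i : Fin m) → kronecker i i ≡ 1ℤ
  kronecker-diag zero    = refl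
  kronecker-diag (suc i) = kronecker-diag i

  kronecker-≢ : ∀ {m} {i j : Fin m} → i ≢ j → kronecker i j ≡ 0ℤ
  kronecker-≢ {i = zero}  {zero}  i≢j = ⊥-elim (i≢j refl)
  kronecker-≢ {i = zero}  {suc j} i≢j = refl
  kronecker-≢ {i = suc i} {zero}  i≢j = refl
  kronecker-≢ {i = suc i} {suc j} i≢j = kronecker-≢ (i≢j ∘ cong suc)

  *-kronecker-sift : ∀ {m} (f : Fin m → ℤ) i j → f j * kronecker i j ≡ f i * kronecker i j
  *-kronecker-sift f zero    zero    = refl
  *-kronecker-sift f zero    (suc j) = trans (*-zeroʳ (f (suc j))) (sym (*-zeroʳ (f zero)))
  *-kronecker-sift f (suc i) zero    = trans (*-zeroʳ (f zero)) (sym (*-zeroʳ (f (suc i))))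
  *-kronecker-sift f (suc i) (suc j) = *-kronecker-sift (f ∘ suc) i j

  sum-*-kronecker : ∀ {m} (f : Fin m → ℤ) i → sum (λ j → f j * kronecker i j) ≡ f i
  sum-*-kronecker f zero = begin
    f zero * 1ℤ + sum (λ j → f (suc j) * 0ℤ)
      ≡⟨ cong₂ _+_ (*-identityʳ (f zero)) (sum-zero (*-zeroʳ ∘ f ∘ suc)) ⟩
    f zero + 0ℤ
      ≡⟨ +-identityʳ (f zero) ⟩
    f zero ∎
  sum-*-kronecker f (suc i) = begin
    f zero * 0ℤ + sum (λ j → f (suc j) * kronecker i j)
      ≡⟨ cong₂ _+_ (*-zeroʳ (f zero)) (sum-*-kronecker (f ∘ suc) i) ⟩
    0ℤ + f (suc i)
      ≡⟨ +-identityˡ (f (suc i)) ⟩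
    f (suc i) ∎

  sum-kronecker : ∀ {m} (i : Fin m) → sum (kronecker i) ≡ 1ℤ
  sum-kronecker {ℕ.suc m} zero = cong (λ z → 1ℤ + z) (sum-zero {m} (λ _ → refl))
  sum-kronecker (suc i) = trans (+-identityˡ _) (sum-kronecker i)

  sum-bounds : ∀ {m} t (f : Fin m → ℤ) →
               (∀ k → toℕ k ℕ.< t → -1ℤ ≤ f k × f k ≤ 0ℤ) →
               (∀ k → t ℕ.≤ toℕ k → 0ℤ ≤ f k × f k ≤ 1ℤ) →
               - + t ≤ sum f × sum f ≤ + (m ℕ.∸ t)
  sum-bounds {ℕ.zero} t f _ _ = neg-≤-pos , +≤+ ℕ.z≤n
  sum-bounds {ℕ.suc m} ℕ.zero f _ above
    with above zero ℕ.z≤n | sum-bounds ℕ.zero (f ∘ suc) (λ _ ()) (λ k _ → above (suc k) ℕ.z≤n)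
  ... | 0≤f₀ , f₀≤1 | 0≤Σ , Σ≤m = +-mono-≤ 0≤f₀ 0≤Σ , +-mono-≤ f₀≤1 Σ≤m
  sum-bounds {ℕ.suc m} (ℕ.suc t) f below above
    with below zero (ℕ.s≤s ℕ.z≤n)
       | sum-bounds t (f ∘ suc) (λ k k<t → below (suc k) (ℕ.s≤s k<t)) (λ k t≤k → above (suc k) (ℕ.s≤s t≤k))
  ... | -1≤f₀ , f₀≤0 | -t≤Σ , Σ≤m∸t =
    subst (_≤ _) (sym (neg-suc t)) (+-mono-≤ -1≤f₀ -t≤Σ) , +-mono-≤ f₀≤0 Σ≤m∸t

module Divisibility where
  open import Data.Integer using (0ℤ; 1ℤ; +[1+_]; -[1+_]; _*_; _<_; +<+; -<-)
  open import Data.Integer.Properties using (*-assoc; *-zeroˡ; *-identityˡ; abs-*)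
  open import Data.Integer.Divisibility.Signed
    using (_∣_; divides; ∣⇒∣ᵤ; ∣ᵤ⇒∣; ∣m∣n⇒∣m+n; ∣m+n∣m⇒∣n; ∣m+n∣n⇒∣m; ∣n⇒∣m*n)
  open import Data.Nat.Divisibility using (∣⇒≤) renaming (_∣_ to _∣ℕ_)
  open import Data.Nat.Primality using (euclidsLemma)
  open import Data.Nat.Properties using (<⇒≱)
  open import Data.Fin.Properties using (suc-injective)
  open import Data.Sum using (map)
  open Sums
  open ≡-Reasoning

  ≡0⇒∣ : ∀ {d i} → i ≡ 0ℤ → d ∣ i
  ≡0⇒∣ {d} refl = divides 0ℤ (sym (*-zeroˡ d))

  ∣-sum : ∀ {d m} {f : Fin m → ℤ} → (∀ i → d ∣ f i) → d ∣ sum f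
  ∣-sum {m = ℕ.zero}  _   = ≡0⇒∣ refl
  ∣-sum {m = ℕ.suc m} d∣f = ∣m∣n⇒∣m+n (d∣f zero) (∣-sum (d∣f ∘ suc))

  ∣-sum-except : ∀ {d m} (f : Fin m → ℤ) i → (∀ j → j ≢ i → d ∣ f j) → d ∣ sum f → d ∣ f i
  ∣-sum-except f zero    d∣others d∣sum = ∣m+n∣n⇒∣m d∣sum (∣-sum (λ j → d∣others (suc j) λ ()))
  ∣-sum-except f (suc i) d∣others d∣sum =
    ∣-sum-except (f ∘ suc) i (λ j j≢i → d∣others (suc j) (j≢i ∘ suc-injective))
                 (∣m+n∣m⇒∣n d∣sum (d∣others zero λ ()))

  prime-∣-* : ∀ {p} → Prime p → ∀ i j → + p ∣ i * j → + p ∣ i ⊎ + p ∣ j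
  prime-∣-* {p} p-prime i j p∣ij =
    map ∣ᵤ⇒∣ ∣ᵤ⇒∣ (euclidsLemma ℤ.∣ i ∣ ℤ.∣ j ∣ p-prime (subst (p ∣ℕ_) (abs-* i j) (∣⇒∣ᵤ p∣ij)))

  ∣-cancel-unit : ∀ {d} u {i} → u * u ≡ 1ℤ → d ∣ u * i → d ∣ i
  ∣-cancel-unit {d} u {i} u²≡1 d∣ui = subst (d ∣_) u[ui]≡i (∣n⇒∣m*n u d∣ui)
    where
    u[ui]≡i : u * (u * i) ≡ i
    u[ui]≡i = begin
      u * (u * i)  ≡⟨ *-assoc u u i ⟨
      u * u * i    ≡⟨ cong (_* i) u²≡1 ⟩
      1ℤ * i       ≡⟨ *-identityˡ i ⟩
      i            ∎

  multiple-between⇒zero : ∀ {P i} → + P ∣ i → - + P < i → i < + P → i ≡ 0ℤ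
  multiple-between⇒zero {i = + ℕ.zero}            _   _          _          = refl
  multiple-between⇒zero {i = +[1+ m ]}            P∣i _          (+<+ i<P) = ⊥-elim (<⇒≱ i<P (∣⇒≤ (∣⇒∣ᵤ P∣i)))
  multiple-between⇒zero {ℕ.zero}    { -[1+ m ]} _   ()         _
  multiple-between⇒zero {ℕ.suc P}   { -[1+ m ]} P∣i (-<- m<P) _ = ⊥-elim (<⇒≱ (ℕ.s≤s m<P) (∣⇒≤ (∣⇒∣ᵤ P∣i)))

module Relations {r m : ℕ.ℕ} (A : Fin r → Fin m → ℤ) where
  open import Data.Integer using (0ℤ; 1ℤ; _+_; _*_)
  open import Data.Integer.Properties using (*-zeroʳ; *-assoc; *-distribʳ-+)
  open import Data.Integer.Divisibility using () renaming (_∣_ to _∣ᵤ_)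
  open import Data.Integer.Divisibility.Signed using (_∣_; ∣⇒∣ᵤ; ∣ᵤ⇒∣; ∣m⇒∣m*n)
  open import Data.Nat.Divisibility using (_∣0; ∣1⇒≡1)
  open import Data.Fin.Properties using (_≟_)
  open import Level using (0ℓ)
  open import Relation.Nullary using (yes; no)
  open import Relation.Unary using (Pred; _∪_; ｛_｝)
  open Sums
  open ≡-Reasoning

  IsRelation : (Fin m → ℤ) → Set
  IsRelation c = ∀ i → sum (λ j → c j * A i j) ≡ 0ℤ

  SupportedOn : Pred (Fin m) 0ℓ → (Fin m → ℤ) → Set
  SupportedOn T c = ∀ j → ¬ T j → c j ≡ 0ℤ

  data HasUnitEntry (c : Fin m → ℤ) : Set where
    unitEntry : ∀ j {u} → c j ≡ u → u * u ≡ 1ℤ → HasUnitEntry c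

  infixl 6 _+[_]·_
  _+[_]·_ : (Fin m → ℤ) → ℤ → (Fin m → ℤ) → Fin m → ℤ
  (c +[ μ ]· d) j = c j + μ * d j

  isRelation-+· : ∀ c μ d → IsRelation c → IsRelation d → IsRelation (c +[ μ ]· d)
  isRelation-+· c μ d c-rel d-rel i = begin
    sum (λ j → (c j + μ * d j) * A i j)
      ≡⟨ sum-cong-≗ (λ j → distrib (c j) (d j) (A i j)) ⟩
    sum (λ j → c j * A i j + μ * (d j * A i j))
      ≡⟨ ∑-distrib-+ (λ j → c j * A i j) (λ j → μ * (d j * A i j)) ⟩
    sum (λ j → c j * A i j) + sum (λ j → μ * (d j * A i j))
      ≡⟨ cong₂ _+_ (c-rel i) (sym (*-distribˡ-sum μ (λ j → d j * A i j))) ⟩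
    0ℤ + μ * sum (λ j → d j * A i j)
      ≡⟨ cong (λ z → 0ℤ + μ * z) (d-rel i) ⟩
    0ℤ + μ * 0ℤ
      ≡⟨ cong (λ z → 0ℤ + z) (*-zeroʳ μ) ⟩
    0ℤ ∎
    where
    distrib : ∀ a b e → (a + μ * b) * e ≡ a * e + μ * (b * e)
    distrib a b e = trans (*-distribʳ-+ e a (μ * b)) (cong (λ z → a * e + z) (*-assoc μ b e))

  supportedOn-+· : ∀ {T} c μ d → SupportedOn T c → SupportedOn T d → SupportedOn T (c +[ μ ]· d)
  supportedOn-+· c μ d c-supp d-supp j j∉T = begin
    c j + μ * d j  ≡⟨ cong₂ (λ a b → a + μ * b) (c-supp j j∉T) (d-supp j j∉T) ⟩
    0ℤ + μ * 0ℤ    ≡⟨ cong (λ z → 0ℤ + z) (*-zeroʳ μ) ⟩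
    0ℤ             ∎

  supportedOn-∪｛｝ : ∀ {T c} j₀ → SupportedOn (T ∪ ｛ j₀ ｝) c → (¬ T j₀ → c j₀ ≡ 0ℤ) → SupportedOn T c
  supportedOn-∪｛｝ j₀ c-supp c-j₀ j j∉T with j₀ ≟ j
  ... | yes refl  = c-j₀ j∉T
  ... | no  j₀≢j = c-supp j [ j∉T , j₀≢j ]′

  supportedOn-eliminate : ∀ {T} j₀ c μ d → SupportedOn (T ∪ ｛ j₀ ｝) c → SupportedOn (T ∪ ｛ j₀ ｝) d →
                          c j₀ + μ * d j₀ ≡ 0ℤ → SupportedOn T (c +[ μ ]· d)
  supportedOn-eliminate j₀ c μ d c-supp d-supp cancels =
    supportedOn-∪｛｝ j₀ (supportedOn-+· c μ d c-supp d-supp) (λ _ → cancels)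

  relation⇒¬linIndep : ∀ {P S} c → P ≢ 1 → IsRelation c → SupportedOn (_∈ S) c → HasUnitEntry c →
                       ¬ LinIndepMod P A S
  relation⇒¬linIndep {P} {S} c P≢1 c-rel c-supp (unitEntry j {u} cⱼ≡u u²≡1) independent =
    P≢1 (∣1⇒≡1 (∣⇒∣ᵤ (subst (+ P ∣_) u²≡1 (∣m⇒∣m*n u P∣u))))
    where
    P∣rows : ∀ i → + P ∣ᵤ sumFin (λ j → c j * A i j)
    P∣rows i = subst (+ P ∣ᵤ_) (sym (trans (sumFin≡sum (λ j → c j * A i j)) (c-rel i))) (P ∣0)

    P∣u : + P ∣ u
    P∣u = subst (+ P ∣_) cⱼ≡u (∣ᵤ⇒∣ (independent c c-supp P∣rows j))

module SpecialMatrix {n : ℕ.ℕ} (x : Fin n → ℤ) where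
  open import Data.Integer using (0ℤ; 1ℤ; -1ℤ; _+_; _*_)
  open import Data.Integer.Properties using (*-identityʳ; *-zeroʳ)
  open import Data.Integer.Tactic.RingSolver using (solve-∀)
  open import Data.Fin using (splitAt)
  open import Data.Fin.Properties using (splitAt-↑ˡ; splitAt-↑ʳ; splitAt⁻¹-↑ˡ; splitAt⁻¹-↑ʳ)
  open import Data.Vec.Functional using (_++_; _∷_)
  open import Data.Vec.Functional.Properties using (lookup-++ˡ; lookup-++ʳ)
  open import Data.Fin.Subset.Properties using (_∈?_)
  open import Data.Bool using (if_then_else_)
  open import Relation.Nullary using (does; yes; no)
  open Sums
  open ≡-Reasoning

  A : Fin n → Fin (n ℕ.+ ℕ.suc n) → ℤ
  A = specialMatrix n x

  open Relations A public

  A-basisElt : ∀ i k → A i (basisElt k) ≡ kronecker i k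
  A-basisElt i k rewrite splitAt-↑ˡ n k (ℕ.suc n) = refl

  A-tip : ∀ i → A i tip ≡ 1ℤ
  A-tip i rewrite splitAt-↑ʳ n (ℕ.suc n) zero = refl

  A-otherElt : ∀ i k → A i (otherElt k) ≡ 1ℤ + x k * kronecker i k
  A-otherElt i k rewrite splitAt-↑ʳ n (ℕ.suc n) (suc k) = refl

  groundSet-elim : ∀ {Q : Fin (n ℕ.+ ℕ.suc n) → Set} →
                   (∀ k → Q (basisElt k)) → Q tip → (∀ k → Q (otherElt k)) → ∀ j → Q j
  groundSet-elim {Q} Q-basis Q-tip Q-other j with splitAt n j in split≡
  ... | inj₁ k       = subst Q (splitAt⁻¹-↑ˡ split≡) (Q-basis k)
  ... | inj₂ zero    = subst Q (splitAt⁻¹-↑ʳ split≡) Q-tip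
  ... | inj₂ (suc k) = subst Q (splitAt⁻¹-↑ʳ split≡) (Q-other k)

  row-expansion : ∀ c i → sum (λ j → c j * A i j) ≡
                  c (basisElt i) + (c tip + sum (c ∘ otherElt)) + x i * c (otherElt i)
  row-expansion c i = begin
    sum (λ j → c j * A i j)
      ≡⟨ sum-↑ n (λ j → c j * A i j) ⟩
    sum (λ k → c (basisElt k) * A i (basisElt k)) +
      (c tip * A i tip + sum (λ k → c (otherElt k) * A i (otherElt k)))
      ≡⟨ cong₂ _+_ (sum-cong-≗ (λ k → cong (c (basisElt k) *_) (A-basisElt i k)))
                   (cong₂ _+_ (cong (c tip *_) (A-tip i))
                              (sum-cong-≗ (λ k → cong (c (otherElt k) *_) (A-otherElt i k)))) ⟩
    sum (λ k → c (basisElt k) * kronecker i k) +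
      (c tip * 1ℤ + sum (λ k → c (otherElt k) * (1ℤ + x k * kronecker i k)))
      ≡⟨ cong₂ _+_ (sum-*-kronecker (c ∘ basisElt) i) (cong₂ _+_ (*-identityʳ (c tip)) other-columns) ⟩
    c (basisElt i) + (c tip + (sum (c ∘ otherElt) + c (otherElt i) * x i))
      ≡⟨ rearrange (c (basisElt i)) (c tip) (sum (c ∘ otherElt)) (c (otherElt i)) (x i) ⟩
    c (basisElt i) + (c tip + sum (c ∘ otherElt)) + x i * c (otherElt i)
      ∎
    where
    distrib : ∀ a b d → a * (1ℤ + b * d) ≡ a + a * b * d
    distrib = solve-∀
    rearrange : ∀ a b s d y → a + (b + (s + d * y)) ≡ a + (b + s) + y * d
    rearrange = solve-∀
    other-columns : sum (λ k → c (otherElt k) * (1ℤ + x k * kronecker i k)) ≡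
                    sum (c ∘ otherElt) + c (otherElt i) * x i
    other-columns = begin
      sum (λ k → c (otherElt k) * (1ℤ + x k * kronecker i k))
        ≡⟨ sum-cong-≗ (λ k → distrib (c (otherElt k)) (x k) (kronecker i k)) ⟩
      sum (λ k → c (otherElt k) + c (otherElt k) * x k * kronecker i k)
        ≡⟨ ∑-distrib-+ (c ∘ otherElt) (λ k → c (otherElt k) * x k * kronecker i k) ⟩
      sum (c ∘ otherElt) + sum (λ k → c (otherElt k) * x k * kronecker i k)
        ≡⟨ cong (λ z → sum (c ∘ otherElt) + z) (sum-*-kronecker (λ k → c (otherElt k) * x k) i) ⟩
      sum (c ∘ otherElt) + c (otherElt i) * x i
        ∎

  row-expansion-++ : ∀ a b g i → sum (λ j → (a ++ (b ∷ g)) j * A i j) ≡ a i + (b + sum g) + x i * g i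
  row-expansion-++ a b g i = trans (row-expansion c i)
    (cong₂ _+_ (cong₂ _+_ (lookup-++ˡ a (b ∷ g) i)
                          (cong₂ _+_ (lookup-++ʳ a (b ∷ g) zero) (sum-cong-≗ (lookup-++ʳ a (b ∷ g) ∘ suc))))
               (cong (x i *_) (lookup-++ʳ a (b ∷ g) (suc i))))
    where
    c : Fin (n ℕ.+ ℕ.suc n) → ℤ
    c = a ++ (b ∷ g)

  isRelation-++ : ∀ {a b g} → (∀ i → a i + (b + sum g) + x i * g i ≡ 0ℤ) → IsRelation (a ++ (b ∷ g))
  isRelation-++ {a} {b} {g} rows i = trans (row-expansion-++ a b g i) (rows i)

  supportedOn-++ : ∀ {T a b g} → (∀ k → ¬ T (basisElt k) → a k ≡ 0ℤ) → (¬ T tip → b ≡ 0ℤ) →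
                   (∀ k → ¬ T (otherElt k) → g k ≡ 0ℤ) → SupportedOn T (a ++ (b ∷ g))
  supportedOn-++ {T} {a} {b} {g} a-supp b-supp g-supp =
    groundSet-elim {Q = λ j → ¬ T j → (a ++ (b ∷ g)) j ≡ 0ℤ}
      (λ k ∉T → trans (lookup-++ˡ a (b ∷ g) k) (a-supp k ∉T))
      (λ ∉T → trans (lookup-++ʳ a (b ∷ g) zero) (b-supp ∉T))
      (λ k ∉T → trans (lookup-++ʳ a (b ∷ g) (suc k)) (g-supp k ∉T))

  -- Coefficients a ++ (b ∷ g) are those of b₁ … bₙ, t, c₁ … cₙ; this is cₖ − t − xₖ bₖ.
  lineRelation : Fin n → Fin (n ℕ.+ ℕ.suc n) → ℤ
  lineRelation k = (λ i → - (x k * kronecker k i)) ++ (-1ℤ ∷ kronecker k)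

  lineRelation-tip : ∀ k → lineRelation k tip ≡ -1ℤ
  lineRelation-tip k = lookup-++ʳ (λ i → - (x k * kronecker k i)) (-1ℤ ∷ kronecker k) zero

  lineRelation-otherElt : ∀ k i → lineRelation k (otherElt i) ≡ kronecker k i
  lineRelation-otherElt k i = lookup-++ʳ (λ i → - (x k * kronecker k i)) (-1ℤ ∷ kronecker k) (suc i)

  lineRelation-isRelation : ∀ k → IsRelation (lineRelation k)
  lineRelation-isRelation k = isRelation-++ λ i → begin
    - (x k * kronecker k i) + (-1ℤ + sum (kronecker k)) + x i * kronecker k i
      ≡⟨ cong₂ (λ s y → - (x k * kronecker k i) + (-1ℤ + s) + y) (sum-kronecker k) (*-kronecker-sift x k i) ⟩
    - (x k * kronecker k i) + 0ℤ + x k * kronecker k i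
      ≡⟨ cancel (x k * kronecker k i) ⟩
    0ℤ ∎
    where
    cancel : ∀ y → - y + 0ℤ + y ≡ 0ℤ
    cancel = solve-∀

  lineRelation-supportedOn : ∀ {T} k → T (basisElt k) → T tip → T (otherElt k) →
                             SupportedOn T (lineRelation k)
  lineRelation-supportedOn {T} k T-basis T-tip T-other = supportedOn-++
    (λ i ∉T → trans (cong (λ d → - (x k * d)) (kronecker-≢ (separated T-basis ∉T))) (cong -_ (*-zeroʳ (x k))))
    (λ ∉T → ⊥-elim (∉T T-tip))
    (λ i ∉T → kronecker-≢ (separated T-other ∉T))
    where
    separated : ∀ {f : Fin n → Fin (n ℕ.+ ℕ.suc n)} {i} → T (f k) → ¬ T (f i) → k ≢ i
    separated T-k ∉T refl = ∉T T-k

  xOutside : Subset (n ℕ.+ ℕ.suc n) → Fin n → ℤ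
  xOutside S k = if does (basisElt k ∈? S) then 0ℤ else x k

  weight : Subset (n ℕ.+ ℕ.suc n) → ℤ
  weight S = 1ℤ + sum (xOutside S)

  xOutside-cases : ∀ S k → xOutside S k ≡ 0ℤ ⊎ xOutside S k ≡ x k
  xOutside-cases S k with basisElt k ∈? S
  ... | yes _ = inj₁ refl
  ... | no _  = inj₂ refl

  xOutside-∈ : ∀ {S k} → basisElt k ∈ S → xOutside S k ≡ 0ℤ
  xOutside-∈ {S} {k} ∈S with basisElt k ∈? S
  ... | yes _  = refl
  ... | no ∉S = ⊥-elim (∉S ∈S)

  xOutside-∉ : ∀ {S k} → basisElt k ∉ S → xOutside S k ≡ x k
  xOutside-∉ {S} {k} ∉S with basisElt k ∈? S
  ... | yes ∈S = ⊥-elim (∉S ∈S)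
  ... | no _   = refl

module Criterion {n : ℕ.ℕ} {x : Fin n → ℤ} (x²≡1 : ∀ k → x k ℤ.* x k ≡ ℤ.1ℤ)
                 (S : Subset (n ℕ.+ ℕ.suc n)) where
  open import Data.Integer using (0ℤ; 1ℤ; -1ℤ; _+_; _*_; _-_)
  open import Data.Integer.Properties using (+-identityˡ; +-identityʳ; +-assoc; *-zeroˡ; *-zeroʳ; *-identityˡ)
  open import Data.Integer.Divisibility.Signed
    using (_∣_; ∣⇒∣ᵤ; ∣ᵤ⇒∣; ∣m∣n⇒∣m+n; ∣m+n∣m⇒∣n; ∣m+n∣n⇒∣m; ∣n⇒∣m*n)
  open import Data.Integer.Tactic.RingSolver using (solve-∀)
  open import Data.Fin.Subset.Properties using (_∈?_)
  open import Data.Vec.Functional using (_++_; _∷_)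
  open import Data.Vec.Functional.Properties using (lookup-++ʳ)
  open import Data.Fin.Properties using (_≟_; any?)
  open import Data.Nat.Primality using (¬prime[1])
  open import Function.Bundles using (_⇔_; mk⇔)
  open import Relation.Nullary using (Dec; yes; no; ¬?; _×-dec_)
  open import Relation.Nullary.Decidable using (decidable-stable)
  open import Relation.Unary using (Decidable; _∪_; ｛_｝)
  open Sums
  open Divisibility
  open SpecialMatrix x
  open ≡-Reasoning

  Paired : Fin n → Set
  Paired k = basisElt k ∈ S × otherElt k ∈ S

  Missed : Fin n → Set
  Missed k = basisElt k ∉ S × otherElt k ∉ S

  Missed? : Decidable Missed
  Missed? k = ¬? (basisElt k ∈? S) ×-dec ¬? (otherElt k ∈? S)

  AtMostOnePaired : Set
  AtMostOnePaired = ∀ k k′ → Paired k → Paired k′ → k ≡ k′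

  data Independent : Set where
    missed      : ∀ {k} → Missed k → (tip ∈ S → ∀ k′ → ¬ Paired k′) → AtMostOnePaired → Independent
    transversal : tip ∉ S → (∀ k → ¬ Paired k) → weight S ≢ 0ℤ → Independent

  module Soundness {P} (c : Fin (n ℕ.+ ℕ.suc n) → ℤ) (c-supp : SupportedOn (_∈ S) c)
                   (P∣rows : ∀ i → + P ∣ sum (λ j → c j * A i j)) where

    s : ℤ
    s = c tip + sum (c ∘ otherElt)

    P∣row : ∀ i → + P ∣ c (basisElt i) + s + x i * c (otherElt i)
    P∣row i = subst (+ P ∣_) (row-expansion c i) (P∣rows i)

    P∣row-∉ : ∀ {i} → basisElt i ∉ S → + P ∣ s + x i * c (otherElt i)
    P∣row-∉ {i} ∉S = subst (+ P ∣_) drop-basis (P∣row i)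
      where
      drop-basis : c (basisElt i) + s + x i * c (otherElt i) ≡ s + x i * c (otherElt i)
      drop-basis = cong (λ z → z + x i * c (otherElt i))
                        (trans (cong (_+ s) (c-supp _ ∉S)) (+-identityˡ s))

    P∣unpaired : + P ∣ s → ∀ {k} → ¬ Paired k → + P ∣ c (otherElt k)
    P∣unpaired P∣s {k} unpaired with otherElt k ∈? S | basisElt k ∈? S
    ... | no ∉S  | _      = ≡0⇒∣ (c-supp _ ∉S)
    ... | yes ∈S | yes ∈S′ = ⊥-elim (unpaired (∈S′ , ∈S))
    ... | yes _  | no ∉S  = ∣-cancel-unit (x k) (x²≡1 k) (∣m+n∣m⇒∣n (P∣row-∉ ∉S) P∣s)

    P∣all : + P ∣ s → (tip ∈ S → ∀ k → ¬ Paired k) → AtMostOnePaired → ∀ j → + P ∣ c j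
    P∣all P∣s tip⇒unpaired atMostOne = groundSet-elim P∣basis P∣tip P∣other
      where
      P∣other : ∀ k → + P ∣ c (otherElt k)
      P∣other k with (basisElt k ∈? S) | (otherElt k ∈? S)
      ... | yes e∈S | yes o∈S = ∣-sum-except (c ∘ otherElt) k
              (λ k′ k′≢k → P∣unpaired P∣s (λ paired′ → k′≢k (atMostOne k′ k paired′ (e∈S , o∈S))))
              (subst (+ P ∣_) s≡Σother P∣s)
        where
        s≡Σother : s ≡ sum (c ∘ otherElt)
        s≡Σother = trans (cong (_+ sum (c ∘ otherElt)) (c-supp tip (λ t∈S → tip⇒unpaired t∈S k (e∈S , o∈S))))
                         (+-identityˡ _)
      ... | no e∉S  | _       = P∣unpaired P∣s (e∉S ∘ proj₁)
      ... | _       | no o∉S  = P∣unpaired P∣s (o∉S ∘ proj₂)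

      P∣tip : + P ∣ c tip
      P∣tip = ∣m+n∣n⇒∣m P∣s (∣-sum P∣other)

      P∣basis : ∀ k → + P ∣ c (basisElt k)
      P∣basis k = ∣m+n∣n⇒∣m (subst (+ P ∣_) (+-assoc (c (basisElt k)) s (x k * c (otherElt k))) (P∣row k))
                             (∣m∣n⇒∣m+n P∣s (∣n⇒∣m*n (x k) (P∣other k)))

    P∣s-missed : ∀ {k} → Missed k → + P ∣ s
    P∣s-missed {k} (e∉S , o∉S) = subst (+ P ∣_) drop-other (P∣row-∉ e∉S)
      where
      drop-other : s + x k * c (otherElt k) ≡ s
      drop-other = begin
        s + x k * c (otherElt k)  ≡⟨ cong (λ z → s + x k * z) (c-supp _ o∉S) ⟩
        s + x k * 0ℤ              ≡⟨ cong (λ z → s + z) (*-zeroʳ (x k)) ⟩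
        s + 0ℤ                    ≡⟨ +-identityʳ s ⟩
        s                         ∎

    x*row-∉ : ∀ {k} → basisElt k ∉ S → x k * (s + x k * c (otherElt k)) ≡ c (otherElt k) + xOutside S k * s
    x*row-∉ {k} e∉S = begin
      x k * (s + x k * c (otherElt k))
        ≡⟨ expand (x k) s (c (otherElt k)) ⟩
      x k * x k * c (otherElt k) + x k * s
        ≡⟨ cong (λ u → u * c (otherElt k) + x k * s) (x²≡1 k) ⟩
      1ℤ * c (otherElt k) + x k * s
        ≡⟨ cong₂ _+_ (*-identityˡ (c (otherElt k))) (cong (_* s) (sym (xOutside-∉ e∉S))) ⟩
      c (otherElt k) + xOutside S k * s ∎
      where
      expand : ∀ y s d → y * (s + y * d) ≡ y * y * d + y * s
      expand = solve-∀

    -- xᵢ times row i is c(cᵢ) + xᵢ s when bᵢ ∉ S, and c(cᵢ) = 0 when bᵢ ∈ S (no pairs); as c(t) = 0,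
    -- these terms sum to (weight S) s.
    P∣weight*s : tip ∉ S → (∀ k → ¬ Paired k) → + P ∣ weight S * s
    P∣weight*s t∉S unpaired = subst (+ P ∣_) sum≡weight*s (∣-sum (λ k → P∣term k (basisElt k ∈? S)))
      where
      term : Fin n → ℤ
      term k = c (otherElt k) + xOutside S k * s

      P∣term : ∀ k → Dec (basisElt k ∈ S) → + P ∣ term k
      P∣term k (yes e∈S) = ≡0⇒∣ (begin
        term k
          ≡⟨ cong₂ (λ o f → o + f * s) (c-supp _ (λ o∈S → unpaired k (e∈S , o∈S))) (xOutside-∈ e∈S) ⟩
        0ℤ + 0ℤ * s
          ≡⟨ cong (λ z → 0ℤ + z) (*-zeroˡ s) ⟩
        0ℤ ∎)
      P∣term k (no e∉S) = subst (+ P ∣_) (x*row-∉ e∉S) (∣n⇒∣m*n (x k) (P∣row-∉ e∉S))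

      factor : ∀ s σ → s + σ * s ≡ (1ℤ + σ) * s
      factor = solve-∀

      sum≡weight*s : sum term ≡ weight S * s
      sum≡weight*s = begin
        sum term
          ≡⟨ ∑-distrib-+ (c ∘ otherElt) (λ k → xOutside S k * s) ⟩
        sum (c ∘ otherElt) + sum (λ k → xOutside S k * s)
          ≡⟨ cong₂ _+_ Σother≡s (sym (*-distribʳ-sum s (xOutside S))) ⟩
        s + sum (xOutside S) * s
          ≡⟨ factor s (sum (xOutside S)) ⟩
        weight S * s ∎
        where
        Σother≡s : sum (c ∘ otherElt) ≡ s
        Σother≡s = sym (trans (cong (_+ sum (c ∘ otherElt)) (c-supp tip t∉S)) (+-identityˡ _))

  independent⇒linIndep : ∀ {P} → Prime P → (+ P ∣ weight S → weight S ≡ 0ℤ) → Independent → LinIndepMod P A S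
  independent⇒linIndep {P} P-prime weight-small independent c c-supp P∣rows j =
    ∣⇒∣ᵤ (P∣all (P∣s independent) (tip⇒unpaired independent) (atMostOne independent) j)
    where
    open Soundness c c-supp (λ i → subst (+ P ∣_) (sumFin≡sum (λ j → c j * A i j)) (∣ᵤ⇒∣ (P∣rows i)))

    P∣s : Independent → + P ∣ s
    P∣s (missed k-missed _ _) = P∣s-missed k-missed
    P∣s (transversal t∉S unpaired weight≢0) with prime-∣-* P-prime (weight S) s (P∣weight*s t∉S unpaired)
    ... | inj₁ P∣weight = ⊥-elim (weight≢0 (weight-small P∣weight))
    ... | inj₂ P∣s     = P∣s

    tip⇒unpaired : Independent → tip ∈ S → ∀ k → ¬ Paired k
    tip⇒unpaired (missed _ tip⇒unpaired _)   = tip⇒unpaired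
    tip⇒unpaired (transversal t∉S _ _) t∈S = ⊥-elim (t∉S t∈S)

    atMostOne : Independent → AtMostOnePaired
    atMostOne (missed _ _ atMostOne)       = atMostOne
    atMostOne (transversal _ unpaired _) k _ paired _ = ⊥-elim (unpaired k paired)

  transversalBasis : Fin n → ℤ
  transversalBasis i = 1ℤ - x i * xOutside S i

  transversalRelation : Fin (n ℕ.+ ℕ.suc n) → ℤ
  transversalRelation = transversalBasis ++ (- weight S ∷ xOutside S)

  transversalRelation-isRelation : IsRelation transversalRelation
  transversalRelation-isRelation = isRelation-++ (λ i → cancel (x i * xOutside S i) (sum (xOutside S)))
    where
    cancel : ∀ y σ → 1ℤ - y + (- (1ℤ + σ) + σ) + y ≡ 0ℤ
    cancel = solve-∀

  transversalRelation-supportedOn : (∀ k → ¬ Missed k) → SupportedOn ((_∈ S) ∪ ｛ tip ｝) transversalRelation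
  transversalRelation-supportedOn noneMissed = supportedOn-++
    (λ i ∉S∪t → trans (cong (λ f → 1ℤ - x i * f) (xOutside-∉ (∉S∪t ∘ inj₁))) (cong (λ z → 1ℤ - z) (x²≡1 i)))
    (λ ∉S∪t → ⊥-elim (∉S∪t (inj₂ refl)))
    (λ i ∉S∪t → xOutside-∈ (decidable-stable (basisElt i ∈? S) (λ e∉S → noneMissed i (e∉S , ∉S∪t ∘ inj₁))))

  allInside⇒weight≡1 : (∀ k → basisElt k ∈ S) → weight S ≡ 1ℤ
  allInside⇒weight≡1 allInside = cong (λ z → 1ℤ + z) (sum-zero (λ k → xOutside-∈ (allInside k)))

  transversalRelation-tip : transversalRelation tip ≡ - weight S
  transversalRelation-tip = lookup-++ʳ transversalBasis (- weight S ∷ xOutside S) zero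

  transversalRelation-otherElt : ∀ i → transversalRelation (otherElt i) ≡ xOutside S i
  transversalRelation-otherElt i = lookup-++ʳ transversalBasis (- weight S ∷ xOutside S) (suc i)

  lineRelation-supportedOn-∪tip : ∀ {k} → Paired k → SupportedOn ((_∈ S) ∪ ｛ tip ｝) (lineRelation k)
  lineRelation-supportedOn-∪tip {k} (e∈S , o∈S) = lineRelation-supportedOn k (inj₁ e∈S) (inj₂ refl) (inj₁ o∈S)

  inside-outside-≢ : ∀ {k i} → basisElt k ∈ S → basisElt i ∉ S → k ≢ i
  inside-outside-≢ e∈S e∉S refl = e∉S e∈S

  allInside⊎someOutside : (∀ k → basisElt k ∈ S) ⊎ ∃ λ k → basisElt k ∉ S
  allInside⊎someOutside with any? (λ k → ¬? (basisElt k ∈? S))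
  ... | yes someOutside = inj₂ someOutside
  ... | no noneOutside  = inj₁ (λ k → decidable-stable (basisElt k ∈? S) (λ e∉S → noneOutside (k , e∉S)))

  transversalRelation-hasUnitEntry : HasUnitEntry transversalRelation
  transversalRelation-hasUnitEntry with allInside⊎someOutside
  ... | inj₂ (k , e∉S) =
    unitEntry (otherElt k) (trans (transversalRelation-otherElt k) (xOutside-∉ e∉S)) (x²≡1 k)
  ... | inj₁ allInside =
    unitEntry tip (trans transversalRelation-tip (cong -_ (allInside⇒weight≡1 allInside))) refl

  module _ {P} (P≢1 : P ≢ 1) where

    paired∧tip⇒¬linIndep : ∀ {k} → Paired k → tip ∈ S → ¬ LinIndepMod P A S
    paired∧tip⇒¬linIndep {k} (e∈S , o∈S) t∈S = relation⇒¬linIndep (lineRelation k) P≢1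
      (lineRelation-isRelation k)
      (lineRelation-supportedOn k e∈S t∈S o∈S)
      (unitEntry tip (lineRelation-tip k) refl)

    twoPaired⇒¬linIndep : ∀ {k k′} → Paired k → Paired k′ → k ≢ k′ → ¬ LinIndepMod P A S
    twoPaired⇒¬linIndep {k} {k′} paired paired′ k≢k′ = relation⇒¬linIndep difference P≢1
      (isRelation-+· (lineRelation k) -1ℤ (lineRelation k′)
        (lineRelation-isRelation k) (lineRelation-isRelation k′))
      (supportedOn-eliminate tip (lineRelation k) -1ℤ (lineRelation k′)
        (lineRelation-supportedOn-∪tip paired) (lineRelation-supportedOn-∪tip paired′)
        (cong₂ combine (lineRelation-tip k) (lineRelation-tip k′)))
      (unitEntry (otherElt k)
        (cong₂ combine (trans (lineRelation-otherElt k k) (kronecker-diag k))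
                       (trans (lineRelation-otherElt k′ k) (kronecker-≢ (k≢k′ ∘ sym))))
        refl)
      where
      difference : Fin (n ℕ.+ ℕ.suc n) → ℤ
      difference = lineRelation k +[ -1ℤ ]· lineRelation k′
      combine : ℤ → ℤ → ℤ
      combine a b = a + -1ℤ * b

    noneMissed∧tip⇒¬linIndep : (∀ k → ¬ Missed k) → (tip ∉ S → weight S ≡ 0ℤ) → ¬ LinIndepMod P A S
    noneMissed∧tip⇒¬linIndep noneMissed weight≡0 = relation⇒¬linIndep transversalRelation P≢1
      transversalRelation-isRelation
      (supportedOn-∪｛｝ tip (transversalRelation-supportedOn noneMissed)
        (λ t∉S → trans transversalRelation-tip (cong -_ (weight≡0 t∉S))))
      transversalRelation-hasUnitEntry

    noneMissed∧paired⇒¬linIndep : ∀ {k} → (∀ k → ¬ Missed k) → Paired k → ¬ LinIndepMod P A S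
    noneMissed∧paired⇒¬linIndep {k} noneMissed paired@(e∈S , _) = relation⇒¬linIndep eliminated P≢1
      (isRelation-+· transversalRelation (- weight S) (lineRelation k)
        transversalRelation-isRelation (lineRelation-isRelation k))
      (supportedOn-eliminate tip transversalRelation (- weight S) (lineRelation k)
        (transversalRelation-supportedOn noneMissed) (lineRelation-supportedOn-∪tip paired)
        (trans (cong₂ combine transversalRelation-tip (lineRelation-tip k)) (cancel (weight S))))
      eliminated-hasUnitEntry
      where
      eliminated : Fin (n ℕ.+ ℕ.suc n) → ℤ
      eliminated = transversalRelation +[ - weight S ]· lineRelation k
      combine : ℤ → ℤ → ℤ
      combine a b = a + - weight S * b
      cancel : ∀ w → - w + - w * -1ℤ ≡ 0ℤ
      cancel = solve-∀
      eliminated-hasUnitEntry : HasUnitEntry eliminated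
      eliminated-hasUnitEntry with allInside⊎someOutside
      ... | inj₂ (i , e∉S) = unitEntry (otherElt i)
              (begin
                combine (transversalRelation (otherElt i)) (lineRelation k (otherElt i))
                  ≡⟨ cong₂ combine (trans (transversalRelation-otherElt i) (xOutside-∉ e∉S))
                                   (trans (lineRelation-otherElt k i)
                                          (kronecker-≢ (inside-outside-≢ e∈S e∉S))) ⟩
                x i + - weight S * 0ℤ
                  ≡⟨ cong (λ z → x i + z) (*-zeroʳ (- weight S)) ⟩
                x i + 0ℤ
                  ≡⟨ +-identityʳ (x i) ⟩
                x i ∎)
              (x²≡1 i)
      ... | inj₁ allInside = unitEntry (otherElt k)
              (begin
                combine (transversalRelation (otherElt k)) (lineRelation k (otherElt k))
                  ≡⟨ cong₂ combine (trans (transversalRelation-otherElt k) (xOutside-∈ e∈S))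
                                   (trans (lineRelation-otherElt k k) (kronecker-diag k)) ⟩
                0ℤ + - weight S * 1ℤ
                  ≡⟨ cong (λ w → 0ℤ + - w * 1ℤ) (allInside⇒weight≡1 allInside) ⟩
                -1ℤ ∎)
              refl

  linIndep⇒independent : ∀ {P} → P ≢ 1 → LinIndepMod P A S → Independent
  linIndep⇒independent P≢1 linIndep with any? Missed?
  ... | yes (_ , k-missed) = missed k-missed
          (λ t∈S k paired → paired∧tip⇒¬linIndep P≢1 paired t∈S linIndep)
          (λ k k′ paired paired′ →
             decidable-stable (k ≟ k′) (λ k≢k′ → twoPaired⇒¬linIndep P≢1 paired paired′ k≢k′ linIndep))
  ... | no someMissed = transversal
          (λ t∈S → noneMissed∧tip⇒¬linIndep P≢1 noneMissed (λ t∉S → ⊥-elim (t∉S t∈S)) linIndep)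
          (λ k paired → noneMissed∧paired⇒¬linIndep P≢1 noneMissed paired linIndep)
          (λ weight≡0 → noneMissed∧tip⇒¬linIndep P≢1 noneMissed (λ _ → weight≡0) linIndep)
    where
    noneMissed : ∀ k → ¬ Missed k
    noneMissed k k-missed = someMissed (k , k-missed)

  linIndep⇔independent : ∀ {P} → Prime P → (+ P ∣ weight S → weight S ≡ 0ℤ) → LinIndepMod P A S ⇔ Independent
  linIndep⇔independent P-prime weight-small =
    mk⇔ (linIndep⇒independent (λ P≡1 → ¬prime[1] (subst Prime P≡1 P-prime)))
        (independent⇒linIndep P-prime weight-small)

module SignPattern {n : ℕ.ℕ} (t : ℕ.ℕ) {x : Fin n → ℤ}
                   (x-neg : ∀ k → toℕ k ℕ.< t → x k ≡ ℤ.-1ℤ) (x-pos : ∀ k → t ℕ.≤ toℕ k → x k ≡ ℤ.1ℤ) where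
  open import Data.Integer using (0ℤ; 1ℤ; -1ℤ; _+_; _*_; _≤_; _<_; +≤+; -≤+; +<+)
  open import Data.Integer.Properties
    using (≤-refl; ≤-trans; ≤-<-trans; <-≤-trans; ≤∧≢⇒<; i≤suc[i]; i≢suc[i]; neg-mono-≤; +-monoʳ-≤)
  open import Data.Integer.Divisibility.Signed using (_∣_)
  open import Data.Nat.Properties using (≮⇒≥)
  open import Relation.Nullary using (yes; no)
  open Sums
  open Divisibility
  open SpecialMatrix x

  x²≡1 : ∀ k → x k * x k ≡ 1ℤ
  x²≡1 k with toℕ k ℕ.<? t
  ... | yes k<t rewrite x-neg k k<t = refl
  ... | no  k≮t rewrite x-pos k (≮⇒≥ k≮t) = refl

  weight-divisible⇒zero : ∀ S {P} → ℕ.suc (n ℕ.∸ t) ℕ.< t → t ℕ.≤ P → + P ∣ weight S → weight S ≡ 0ℤ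
  weight-divisible⇒zero S {P} suc[n∸t]<t t≤P P∣weight = multiple-between⇒zero P∣weight lower upper
    where
    Between : ℤ → ℤ → ℤ → Set
    Between lo hi v = lo ≤ v × v ≤ hi

    below : ∀ k → toℕ k ℕ.< t → Between -1ℤ 0ℤ (xOutside S k)
    below k k<t = [ (λ f≡0 → subst (Between -1ℤ 0ℤ) (sym f≡0) (-≤+ , ≤-refl))
                  , (λ f≡x → subst (Between -1ℤ 0ℤ) (sym (trans f≡x (x-neg k k<t))) (≤-refl , -≤+)) ]′
                  (xOutside-cases S k)

    above : ∀ k → t ℕ.≤ toℕ k → Between 0ℤ 1ℤ (xOutside S k)
    above k t≤k = [ (λ f≡0 → subst (Between 0ℤ 1ℤ) (sym f≡0) (≤-refl , +≤+ ℕ.z≤n))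
                  , (λ f≡x → subst (Between 0ℤ 1ℤ) (sym (trans f≡x (x-pos k t≤k))) (+≤+ ℕ.z≤n , ≤-refl)) ]′
                  (xOutside-cases S k)

    Σ-bounds : - + t ≤ sum (xOutside S) × sum (xOutside S) ≤ + (n ℕ.∸ t)
    Σ-bounds = sum-bounds t (xOutside S) below above

    lower : - + P < weight S
    lower = ≤-<-trans (≤-trans (neg-mono-≤ (+≤+ t≤P)) (proj₁ Σ-bounds))
                      (≤∧≢⇒< (i≤suc[i] (sum (xOutside S))) i≢suc[i])

    upper : weight S < + P
    upper = ≤-<-trans (+-monoʳ-≤ 1ℤ (proj₂ Σ-bounds)) (<-≤-trans (+<+ suc[n∸t]<t) (+≤+ t≤P))

open import Data.Nat using (ℕ; suc; _+_; _≤_; _<_; _∸_; _*_)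
open import Data.Nat.Properties using (∸-+-assoc; +-comm; +-identityʳ; m+n∸m≡n; ≤-refl)
open import Data.Nat.Primality using (prime⇒nonTrivial)
open import Function.Bundles using (_⇔_)
open import Function.Properties.Equivalence using () renaming (trans to ⇔-trans; sym to ⇔-sym)

[2p∸2]∸p≡p∸2 : ∀ p → (2 * p ∸ 2) ∸ p ≡ p ∸ 2
[2p∸2]∸p≡p∸2 p = begin
  (2 * p ∸ 2) ∸ p  ≡⟨ ∸-+-assoc (2 * p) 2 p ⟩
  2 * p ∸ (2 + p)  ≡⟨ cong (2 * p ∸_) (+-comm 2 p) ⟩
  2 * p ∸ (p + 2)  ≡⟨ ∸-+-assoc (2 * p) p 2 ⟨
  (2 * p ∸ p) ∸ 2  ≡⟨ cong (_∸ 2) (trans (m+n∸m≡n p (p + 0)) (+-identityʳ p)) ⟩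
  p ∸ 2            ∎
  where open ≡-Reasoning

suc[p∸2]<p : ∀ {p} → 2 ≤ p → suc (p ∸ 2) < p
suc[p∸2]<p (ℕ.s≤s (ℕ.s≤s _)) = ≤-refl

proposition4p1 : (p n : ℕ) → Prime p → n ≡ 2 * p ∸ 2 →
    (M : Matroid (n + suc n)) → (x : Fin n → ℤ) →
    IsSpecialStdRep p n M x →
    (∀ k → toℕ k < p → x k ≡ - (+ 1)) →
    (∀ k → p ≤ toℕ k → x k ≡ + 1) →
    ∀ q → Prime q → p ≤ q → Represents q (specialMatrix n x) M
-- Only the representation over GF(p) is used: the matrix alone determines which sets are independent.
proposition4p1 p n p-prime n≡2p∸2 _ x (_ , _ , represents-p) x-neg x-pos _ q-prime p≤q S =
  ⇔-trans (represents-p S) (⇔-trans (criterion p-prime ≤-refl) (⇔-sym (criterion q-prime p≤q)))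
  where
  open SignPattern p x-neg x-pos

  suc[n∸p]<p : suc (n ∸ p) < p
  suc[n∸p]<p = subst (λ m → suc m < p) (sym (trans (cong (_∸ p) n≡2p∸2) ([2p∸2]∸p≡p∸2 p)))
                     (suc[p∸2]<p (ℕ.nonTrivial⇒n>1 p {{prime⇒nonTrivial p-prime}}))

  criterion : ∀ {P} → Prime P → p ≤ P → LinIndepMod P (specialMatrix n x) S ⇔ Criterion.Independent x²≡1 S
  criterion P-prime p≤P =
    Criterion.linIndep⇔independent x²≡1 S P-prime (weight-divisible⇒zero S suc[n∸p]<p p≤P)
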